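{- Let $G$ and $H$ be two connected graphs of order $n_1\ge 2$ and $n_2\ge 2$, respectively. If $D(H)\le 2$, then $pd(G\odot H)\le \dim(G)+\dim(H)+2$.
   Context: $D(H)$ is the diameter of $H$ and $d$ the shortest-path distance. For a connected graph $F$ and an ordered set $S=\{s_1,\dots,s_k\}$ of vertices, $r(v|S)=(d(v,s_1),\dots,d(v,s_k))$; $S$ is a resolving set if $r(u|S)\neq r(v|S)$ for all distinct vertices $u,v$; $\dim(F)$ is the minimum cardinality of a resolving set. For an ordered partition $\Pi=\{P_1,\dots,P_t\}$ of $V(F)$, $r(v|\Pi)=(d(v,P_1),\dots,d(v,P_t))$ where $d(v,P_i)=\min_{u\in P_i}d(v,u)$; $\Pi$ is a resolving partition if $r(u|\Pi)\ne r(v|\Pi)$ for all distinct $u,v$; $pd(F)$ is the minimum number of sets in a resolving partition. For graphs $G$ of order $n_1$ (vertices $v_1,\dots,v_{n_1}$) and $H$, the corona product $G\odot H$ is obtained from one copy of $G$ and $n_1$ copies $H_1,\dots,H_{n_1}$ of $H$ by joining $v_i$ to every vertex of $H_i$. -}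

module Defs where

open import Level using (0ℓ)
open import Data.Nat using (ℕ; zero; suc; _≤_; _+_)
open import Data.Fin using (Fin)
open import Data.Sum using (_⊎_; inj₁; inj₂)
open import Data.Product using (Σ; ∃; _×_; _,_)
open import Relation.Nullary using (¬_)
open import Relation.Binary.PropositionalEquality using (_≡_; _≢_)
open import Function.Definitions using (Injective)

record Graph (V : Set) : Set₁ where
  field
    Adj   : V → V → Set
    sym   : ∀ {u v} → Adj u v → Adj v u
    irrfl : ∀ {v} → ¬ Adj v v
open Graph public

data Walk {V : Set} (F : Graph V) : V → V → ℕ → Set where
  here : ∀ {v} → Walk F v v zero
  step : ∀ {u w v k} → Adj F u w → Walk F w v k → Walk F u v (suc k)

Connected : {V : Set} → Graph V → Set
Connected F = ∀ u v → ∃ λ k → Walk F u v k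

IsDist : {V : Set} → Graph V → V → V → ℕ → Set
IsDist F u v k = Walk F u v k × (∀ m → Walk F u v m → k ≤ m)

DiamAtMost : {V : Set} → Graph V → ℕ → Set
DiamAtMost F m = ∀ u v k → IsDist F u v k → k ≤ m

IsResolvingSet : {V : Set} → Graph V → (k : ℕ) → (Fin k → V) → Set
IsResolvingSet F k S =
  Injective _≡_ _≡_ S ×
  (∀ u v → u ≢ v → ∃ λ i → ∃ λ a → ∃ λ b →
     IsDist F u (S i) a × IsDist F v (S i) b × a ≢ b)

IsMetricDim : {V : Set} → Graph V → ℕ → Set
IsMetricDim F k =
  (Σ (Fin k → _) λ S → IsResolvingSet F k S) ×
  (∀ k' (S : Fin k' → _) → IsResolvingSet F k' S → k ≤ k')

IsPartition : {V : Set} → (t : ℕ) → (V → Fin t) → Set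
IsPartition {V} t cls = ∀ i → ∃ λ (v : V) → cls v ≡ i

IsSetDist : {V : Set} → Graph V → {t : ℕ} → (V → Fin t) → V → Fin t → ℕ → Set
IsSetDist F cls v i k =
  (∃ λ u → cls u ≡ i × IsDist F v u k) ×
  (∀ u m → cls u ≡ i → IsDist F v u m → k ≤ m)

IsResolvingPartition : {V : Set} → Graph V → (t : ℕ) → (V → Fin t) → Set
IsResolvingPartition F t cls =
  IsPartition t cls ×
  (∀ u v → u ≢ v → ∃ λ i → ∃ λ a → ∃ λ b →
     IsSetDist F cls u i a × IsSetDist F cls v i b × a ≢ b)

IsPartitionDim : {V : Set} → Graph V → ℕ → Set
IsPartitionDim F t =
  (Σ (_ → Fin t) λ cls → IsResolvingPartition F t cls) ×
  (∀ t' (cls : _ → Fin t') → IsResolvingPartition F t' cls → t ≤ t')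

-- Corona product G ⊙ H: vertices inj₁ i = v_i of G, inj₂ (i , x) = vertex x of copy H_i.
CoronaV : ℕ → ℕ → Set
CoronaV n₁ n₂ = Fin n₁ ⊎ (Fin n₁ × Fin n₂)

coronaAdj : ∀ {n₁ n₂} → Graph (Fin n₁) → Graph (Fin n₂) →
            CoronaV n₁ n₂ → CoronaV n₁ n₂ → Set
coronaAdj G H (inj₁ a) (inj₁ b) = Adj G a b
coronaAdj G H (inj₁ a) (inj₂ (j , y)) = a ≡ j
coronaAdj G H (inj₂ (i , x)) (inj₁ b) = i ≡ b
coronaAdj G H (inj₂ (i , x)) (inj₂ (j , y)) = i ≡ j × Adj H x y

private
  open import Relation.Binary.PropositionalEquality using () renaming (sym to ≡sym)

  cSym : ∀ {n₁ n₂} (G : Graph (Fin n₁)) (H : Graph (Fin n₂)) {u v} →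
         coronaAdj G H u v → coronaAdj G H v u
  cSym G H {inj₁ a} {inj₁ b} p = Graph.sym G p
  cSym G H {inj₁ a} {inj₂ _} p = ≡sym p
  cSym G H {inj₂ _} {inj₁ b} p = ≡sym p
  cSym G H {inj₂ _} {inj₂ _} (p , q) = ≡sym p , Graph.sym H q

  cIrr : ∀ {n₁ n₂} (G : Graph (Fin n₁)) (H : Graph (Fin n₂)) {v} →
         ¬ coronaAdj G H v v
  cIrr G H {inj₁ a} p = irrfl G p
  cIrr G H {inj₂ _} (_ , q) = irrfl H q

_⊙_ : ∀ {n₁ n₂} → Graph (Fin n₁) → Graph (Fin n₂) → Graph (CoronaV n₁ n₂)
G ⊙ H = record { Adj = coronaAdj G H ; sym = λ {u} {v} → cSym G H {u} {v} ; irrfl = λ {v} → cIrr G H {v} }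

module Submission where

-- Take metric bases S = {s_1,…,s_k} of G and W = {w_1,…,w_m} of H and
-- partition the vertices of G ⊙ H into
--   * the singletons {s_j} (k classes),
--   * the sets {w_l in every copy H_i} (m classes),
--   * the remaining vertices of G (one class, if nonempty),
--   * the remaining vertices of all the copies (one class, if nonempty).
-- Two vertices of G are separated by some {s_j}; a vertex of G and a vertex
-- of a copy are separated by the class of the latter (distances 0 and 1);
-- vertices in different copies H_i, H_i' are separated by the {s_j}
-- separating v_i and v_i' (distances shift by one); two vertices of the same
-- copy are separated by some class {w_l}, because D(H) ≤ 2 makes the copy
-- of w_l in H_i at least as close as any other copy.

open import Defs hiding (sym)
open import Data.Nat using (ℕ; suc; _≤_; _+_; z≤n; s≤s; pred)
open import Data.Nat.Properties using (≤-trans; n≤1+n; +-mono-≤; +-monoʳ-≤)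
open import Data.Nat.Tactic.RingSolver using (solve-∀)
open import Data.Fin using (Fin; zero)
open import Data.Fin.Properties using (any?; +↔⊎) renaming (_≟_ to _≟ᶠ_)
open import Data.Sum using (_⊎_; inj₁; inj₂)
open import Data.Sum.Properties using (inj₁-injective; inj₂-injective)
open import Data.Sum.Function.Propositional using (_⊎-↔_)
open import Data.Product using (∃; _×_; _,_; proj₁; proj₂)
open import Data.Empty using (⊥-elim)
open import Relation.Nullary using (¬_; Dec; yes; no)
open import Relation.Nullary.Decidable using (¬?)
open import Relation.Binary.PropositionalEquality
open import Function using (_∘_)
open import Function.Bundles using (_↔_; Inverse)
open import Function.Definitions using (Injective)
open import Function.Properties.Inverse using (↔-sym; ↔-trans)

module _ {V : Set} (F : Graph V) where

  -- d(v, P_κ) = α for the class P_κ = {u | cls u ≡ κ}; IsSetDist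
  -- of Defs is the special case K = Fin t.
  IsClassDist : {K : Set} → (V → K) → V → K → ℕ → Set
  IsClassDist cls v κ α =
    (∃ λ u → cls u ≡ κ × IsDist F v u α) ×
    (∀ u m → cls u ≡ κ → IsDist F v u m → α ≤ m)

  Resolves : {K : Set} → (V → K) → Set
  Resolves cls = ∀ u v → u ≢ v → ∃ λ κ → ∃ λ α → ∃ λ β →
    IsClassDist cls u κ α × IsClassDist cls v κ β × α ≢ β

  classDist-intro : ∀ {K} {cls : V → K} {v u₀ κ α} →
    cls u₀ ≡ κ → IsDist F v u₀ α →
    (∀ u m → cls u ≡ κ → Walk F v u m → α ≤ m) →
    IsClassDist cls v κ α
  classDist-intro u₀∈κ d bound =
    (_ , u₀∈κ , d) , λ u m u∈κ du → bound u m u∈κ (proj₁ du)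

  singletonClassDist : ∀ {K} {cls : V → K} {v u₀ κ α} →
    cls u₀ ≡ κ → (∀ u → cls u ≡ κ → u ≡ u₀) → IsDist F v u₀ α →
    IsClassDist cls v κ α
  singletonClassDist {cls = cls} {v} {u₀} {κ} {α} u₀∈κ only d = classDist-intro u₀∈κ d bound
    where
    bound : ∀ u m → cls u ≡ κ → Walk F v u m → α ≤ m
    bound u m u∈κ w with only u u∈κ
    ... | refl = proj₂ d m w

  ownClassDist : ∀ {K} (cls : V → K) v → IsClassDist cls v (cls v) 0
  ownClassDist cls v = classDist-intro refl (here , λ _ _ → z≤n) (λ _ _ _ _ → z≤n)

  walk-positive : ∀ {u v m} → u ≢ v → Walk F u v m → 1 ≤ m
  walk-positive u≢v here = ⊥-elim (u≢v refl)
  walk-positive _ (step _ _) = s≤s z≤n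

  neighbourClassDist : ∀ {K} {cls : V → K} {v u κ} →
    cls v ≢ κ → Adj F v u → cls u ≡ κ → IsClassDist cls v κ 1
  neighbourClassDist {cls = cls} {v} v∉κ vu u∈κ =
    classDist-intro u∈κ
      (step vu here , λ _ → walk-positive (λ { refl → irrfl F vu }))
      (λ u' _ u'∈κ → walk-positive (λ { refl → v∉κ u'∈κ }))

  relabel : ∀ {K t} (enc : K ↔ Fin t) (cls : V → K) →
    (∀ κ → ∃ λ v → cls v ≡ κ) → Resolves cls →
    IsResolvingPartition F t (Inverse.to enc ∘ cls)
  relabel {K} {t} enc cls inhabited resolves = nonempty , separated
    where
    open Inverse enc using (to; from; strictlyInverseˡ; strictlyInverseʳ)

    to-injective : ∀ {κ κ'} → to κ ≡ to κ' → κ ≡ κ'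
    to-injective {κ} {κ'} eq =
      trans (sym (strictlyInverseʳ κ)) (trans (cong from eq) (strictlyInverseʳ κ'))

    nonempty : IsPartition t (to ∘ cls)
    nonempty i with inhabited (from i)
    ... | v , v∈ = v , trans (cong to v∈) (strictlyInverseˡ i)

    transport : ∀ {v κ α} → IsClassDist cls v κ α → IsSetDist F (to ∘ cls) v (to κ) α
    transport ((u , u∈κ , d) , bound) =
      (u , cong to u∈κ , d) , λ u' m u'∈ → bound u' m (to-injective u'∈)

    separated : ∀ u v → u ≢ v → ∃ λ i → ∃ λ a → ∃ λ b →
      IsSetDist F (to ∘ cls) u i a × IsSetDist F (to ∘ cls) v i b × a ≢ b
    separated u v u≢v with resolves u v u≢v
    ... | κ , α , β , du , dv , α≢β = to κ , α , β , transport du , transport dv , α≢β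

-- Landmark labelling: given an injective S : Fin k → Fin n, label each
-- landmark S j by j and all other elements by a single extra label, which
-- exists only if some element is not a landmark.

record Labelling {k n : ℕ} (S : Fin k → Fin n) : Set where
  field
    extra           : ℕ
    extra≤1         : extra ≤ 1
    label           : Fin n → Fin k ⊎ Fin extra
    label-landmark  : ∀ j → label (S j) ≡ inj₁ j
    landmark-only   : ∀ a j → label a ≡ inj₁ j → a ≡ S j
    extra-inhabited : ∀ z → ∃ λ a → label a ≡ inj₂ z

  label-onto : ∀ κ → ∃ λ a → label a ≡ κ
  label-onto (inj₁ j) = S j , label-landmark j
  label-onto (inj₂ z) = extra-inhabited z

module _ {k n : ℕ} (S : Fin k → Fin n) (S-inj : Injective _≡_ _≡_ S) where

  IsLandmark : Fin n → Set
  IsLandmark a = ∃ λ j → S j ≡ a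

  landmark? : ∀ a → Dec (IsLandmark a)
  landmark? a = any? λ j → S j ≟ᶠ a

  labelBy : ∀ {c} → (∀ a → ¬ IsLandmark a → Fin c) → Fin n → Fin k ⊎ Fin c
  labelBy rest a with landmark? a
  ... | yes (j , _) = inj₁ j
  ... | no a∉S = inj₂ (rest a a∉S)

  labelBy-landmark : ∀ {c} (rest : ∀ a → ¬ IsLandmark a → Fin c) j →
    labelBy rest (S j) ≡ inj₁ j
  labelBy-landmark rest j with landmark? (S j)
  ... | yes (j' , Sj'≡Sj) = cong inj₁ (S-inj Sj'≡Sj)
  ... | no Sj∉S = ⊥-elim (Sj∉S (j , refl))

  labelBy-only : ∀ {c} (rest : ∀ a → ¬ IsLandmark a → Fin c) a j →
    labelBy rest a ≡ inj₁ j → a ≡ S j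
  labelBy-only rest a j eq with landmark? a
  labelBy-only rest a j eq | yes (j' , refl) = cong S (inj₁-injective eq)
  labelBy-only rest a j () | no _

  labelBy-outside : ∀ {c} (z : Fin c) a → ¬ IsLandmark a →
    labelBy (λ _ _ → z) a ≡ inj₂ z
  labelBy-outside z a a∉S with landmark? a
  ... | yes a∈S = ⊥-elim (a∉S a∈S)
  ... | no _ = refl

  labelling : Labelling S
  labelling with any? (λ a → ¬? (landmark? a))
  ... | yes (a₀ , a₀∉S) = record
    { extra = 1 ; extra≤1 = s≤s z≤n
    ; label = labelBy (λ _ _ → zero)
    ; label-landmark = labelBy-landmark _
    ; landmark-only = labelBy-only _
    ; extra-inhabited = λ { zero → a₀ , labelBy-outside zero a₀ a₀∉S }
    }
  ... | no allLandmarks = record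
    { extra = 0 ; extra≤1 = z≤n
    ; label = labelBy (λ a a∉S → ⊥-elim (allLandmarks (a , a∉S)))
    ; label-landmark = labelBy-landmark _
    ; landmark-only = labelBy-only _
    ; extra-inhabited = λ ()
    }

module Corona {n₁ n₂} (G : Graph (Fin n₁)) (H : Graph (Fin n₂)) where

  C : Graph (CoronaV n₁ n₂)
  C = G ⊙ H

  base : CoronaV n₁ n₂ → Fin n₁
  base (inj₁ a) = a
  base (inj₂ (i , _)) = i

  liftG : ∀ {a b m} → Walk G a b m → Walk C (inj₁ a) (inj₁ b) m
  liftG here = here
  liftG (step ab w) = step ab (liftG w)

  liftH : ∀ i {x y m} → Walk H x y m → Walk C (inj₂ (i , x)) (inj₂ (i , y)) m
  liftH i here = here
  liftH i (step xy w) = step (refl , xy) (liftH i w)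

  projectG : ∀ {u v m} → Walk C u v m → ∃ λ l → l ≤ m × Walk G (base u) (base v) l
  projectG here = 0 , z≤n , here
  projectG (step {inj₁ _} {inj₁ _} ab w) with projectG w
  ... | l , l≤m , w' = suc l , s≤s l≤m , step ab w'
  projectG (step {inj₁ _} {inj₂ _} refl w) with projectG w
  ... | l , l≤m , w' = l , ≤-trans l≤m (n≤1+n _) , w'
  projectG (step {inj₂ _} {inj₁ _} refl w) with projectG w
  ... | l , l≤m , w' = l , ≤-trans l≤m (n≤1+n _) , w'
  projectG (step {inj₂ _} {inj₂ _} (refl , _) w) with projectG w
  ... | l , l≤m , w' = l , ≤-trans l≤m (n≤1+n _) , w'

  projectFromCopy : ∀ {i x b m} → Walk C (inj₂ (i , x)) (inj₁ b) m →
    ∃ λ l → suc l ≤ m × Walk G i b l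
  projectFromCopy (step {w = inj₁ _} refl w) with projectG w
  ... | l , l≤m , w' = l , s≤s l≤m , w'
  projectFromCopy (step {w = inj₂ _} (refl , _) w) with projectFromCopy w
  ... | l , l<m , w' = l , ≤-trans l<m (n≤1+n _) , w'

  copyWalk : ∀ {i x i' y m} → Walk C (inj₂ (i , x)) (inj₂ (i' , y)) m →
    (i ≡ i' × Walk H x y m) ⊎ 2 ≤ m
  copyWalk here = inj₁ (refl , here)
  copyWalk (step {w = inj₁ _} refl (step _ _)) = inj₂ (s≤s (s≤s z≤n))
  copyWalk (step {w = inj₂ _} (refl , xz) w) with copyWalk w
  ... | inj₁ (refl , w') = inj₁ (refl , step xz w')
  ... | inj₂ 2≤m = inj₂ (≤-trans 2≤m (n≤1+n _))

  baseDist : ∀ {a b α} → IsDist G a b α → IsDist C (inj₁ a) (inj₁ b) α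
  baseDist (w , shortest) =
    liftG w , λ m w' → let l , l≤m , w'' = projectG w' in ≤-trans (shortest l w'') l≤m

  copyToBaseDist : ∀ {i x b α} → IsDist G i b α → IsDist C (inj₂ (i , x)) (inj₁ b) (suc α)
  copyToBaseDist (w , shortest) =
    step refl (liftG w) ,
    λ m w' → let l , l<m , w'' = projectFromCopy w' in ≤-trans (s≤s (shortest l w'')) l<m

  copyLowerBound : DiamAtMost H 2 → ∀ {i x y α} → IsDist H x y α →
    ∀ i' m → Walk C (inj₂ (i , x)) (inj₂ (i' , y)) m → α ≤ m
  copyLowerBound diam {x = x} {y} {α} d i' m w with copyWalk w
  ... | inj₁ (_ , w') = proj₂ d m w'
  ... | inj₂ 2≤m = ≤-trans (diam x y α d) 2≤m

module CoronaPartition {n₁ n₂} (G : Graph (Fin n₁)) (H : Graph (Fin n₂))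
  (diam : DiamAtMost H 2) (i₀ : Fin n₁)
  {k : ℕ} (S : Fin k → Fin n₁) (S-resolving : IsResolvingSet G k S)
  {m : ℕ} (W : Fin m → Fin n₂) (W-resolving : IsResolvingSet H m W)
  where
  open Corona G H

  LG : Labelling S
  LG = labelling S (proj₁ S-resolving)
  LH : Labelling W
  LH = labelling W (proj₁ W-resolving)
  open Labelling LG using () renaming (extra to cG; label to labelG)
  open Labelling LH using () renaming (extra to cH; label to labelH)

  -- Vertices of G are labelled on the left, vertices of copies on the
  -- right; a copy vertex only records which vertex of H it is.
  Class : Set
  Class = (Fin k ⊎ Fin cG) ⊎ (Fin m ⊎ Fin cH)

  cls : CoronaV n₁ n₂ → Class
  cls (inj₁ a) = inj₁ (labelG a)
  cls (inj₂ (_ , x)) = inj₂ (labelH x)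

  -- Every class is nonempty: labels are onto, and copy H_{i₀} exists.
  inhabited : ∀ κ → ∃ λ v → cls v ≡ κ
  inhabited (inj₁ κ) with Labelling.label-onto LG κ
  ... | a , eq = inj₁ a , cong inj₁ eq
  inhabited (inj₂ κ) with Labelling.label-onto LH κ
  ... | x , eq = inj₂ (i₀ , x) , cong inj₂ eq

  G-landmark-class : ∀ j u → cls u ≡ inj₁ (inj₁ j) → u ≡ inj₁ (S j)
  G-landmark-class j (inj₁ a) eq = cong inj₁ (Labelling.landmark-only LG a j (inj₁-injective eq))
  G-landmark-class j (inj₂ _) ()

  H-landmark-class : ∀ l u → cls u ≡ inj₂ (inj₁ l) → ∃ λ i → u ≡ inj₂ (i , W l)
  H-landmark-class l (inj₁ _) ()
  H-landmark-class l (inj₂ (i , x)) eq =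
    i , cong (λ y → inj₂ (i , y)) (Labelling.landmark-only LH x l (inj₂-injective eq))

  G-landmark-dist : ∀ {u j α} → IsDist C u (inj₁ (S j)) α → IsClassDist C cls u (inj₁ (inj₁ j)) α
  G-landmark-dist {j = j} =
    singletonClassDist C (cong inj₁ (Labelling.label-landmark LG j)) (G-landmark-class j)

  H-landmark-dist : ∀ {i x l α} → IsDist H x (W l) α →
    IsClassDist C cls (inj₂ (i , x)) (inj₂ (inj₁ l)) α
  H-landmark-dist {i} {x} {l} {α} d =
    classDist-intro C (cong inj₂ (Labelling.label-landmark LH l)) (sameCopy d) bound
    where
    sameCopy : ∀ {x α} → IsDist H x (W l) α → IsDist C (inj₂ (i , x)) (inj₂ (i , W l)) α
    sameCopy d = liftH i (proj₁ d) , copyLowerBound diam d i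
    bound : ∀ u m → cls u ≡ inj₂ (inj₁ l) → Walk C (inj₂ (i , x)) u m → α ≤ m
    bound u m u∈ w with H-landmark-class l u u∈
    ... | i' , refl = copyLowerBound diam d i' m w

  base-to-copy-class : ∀ a x → IsClassDist C cls (inj₁ a) (inj₂ (labelH x)) 1
  base-to-copy-class a x = neighbourClassDist C {u = inj₂ (a , x)} (λ ()) refl refl

  resolves : Resolves C cls
  resolves (inj₁ a) (inj₁ b) a≢b with proj₂ S-resolving a b (a≢b ∘ cong inj₁)
  ... | j , α , β , da , db , α≢β =
    inj₁ (inj₁ j) , α , β , G-landmark-dist (baseDist da) , G-landmark-dist (baseDist db) , α≢β
  resolves (inj₁ a) (inj₂ (i , x)) _ =
    inj₂ (labelH x) , 1 , 0 , base-to-copy-class a x , ownClassDist C cls (inj₂ (i , x)) , λ ()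
  resolves (inj₂ (i , x)) (inj₁ a) _ =
    inj₂ (labelH x) , 0 , 1 , ownClassDist C cls (inj₂ (i , x)) , base-to-copy-class a x , λ ()
  resolves (inj₂ (i , x)) (inj₂ (i' , y)) ne with i ≟ᶠ i'
  ... | no i≢i' with proj₂ S-resolving i i' i≢i'
  ...   | j , α , β , da , db , α≢β =
    inj₁ (inj₁ j) , suc α , suc β ,
    G-landmark-dist (copyToBaseDist da) , G-landmark-dist (copyToBaseDist db) , α≢β ∘ cong pred
  resolves (inj₂ (i , x)) (inj₂ (i , y)) ne | yes refl
    with proj₂ W-resolving x y (ne ∘ cong (λ z → inj₂ (i , z)))
  ... | l , α , β , dx , dy , α≢β =
    inj₂ (inj₁ l) , α , β , H-landmark-dist dx , H-landmark-dist dy , α≢β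

  classes : ℕ
  classes = (k + cG) + (m + cH)

  encode : Class ↔ Fin classes
  encode = ↔-trans (↔-sym +↔⊎ ⊎-↔ ↔-sym +↔⊎) (↔-sym +↔⊎)

  resolvingPartition : IsResolvingPartition C classes (Inverse.to encode ∘ cls)
  resolvingPartition = relabel C encode cls inhabited resolves

  -- At most one extra class on each side.
  classes-bound : classes ≤ k + m + 2
  classes-bound = subst (classes ≤_) (arith k m)
    (+-mono-≤ (+-monoʳ-≤ k (Labelling.extra≤1 LG)) (+-monoʳ-≤ m (Labelling.extra≤1 LH)))
    where
    arith : ∀ k m → (k + 1) + (m + 1) ≡ k + m + 2
    arith = solve-∀

-- pd(G ⊙ H) is at most the size of the partition above; n₁ ≥ 2 supplies
-- the vertex i₀ used to show every class is nonempty.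

corollary6 : ∀ {n₁ n₂} (G : Graph (Fin n₁)) (H : Graph (Fin n₂)) →
    2 ≤ n₁ → 2 ≤ n₂ → Connected G → Connected H →
    DiamAtMost H 2 →
    ∀ d₁ d₂ p → IsMetricDim G d₁ → IsMetricDim H d₂ →
    IsPartitionDim (G ⊙ H) p → p ≤ d₁ + d₂ + 2
corollary6 G H (s≤s _) _ _ _ diam d₁ d₂ p ((S , S-res) , _) ((W , W-res) , _) (_ , minimal) =
  ≤-trans (minimal classes (Inverse.to encode ∘ cls) resolvingPartition) classes-bound
  where open CoronaPartition G H diam zero S S-res W W-res
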